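{- Let $k \in \mathbb{N}$ (positive integers) and let $Y$ be a Young diagram. Then $Y$ can be covered by a set $C$ of generalized rectangles such that each row and each column of $Y$ is used by at most $k$ rectangles in $C$ if and only if $Y$ has strictly less than $\binom{2k}{k}$ steps.
   Context: For $x \in \mathbb{N}$ let $[x] = \{1,\ldots,x\}$. A Young diagram with $r$ rows and $c$ columns is a subset $Y \subseteq [r] \times [c]$ such that whenever $(i,j) \in Y$, then $(i-1,j) \in Y$ if $i \geq 2$ and $(i,j-1) \in Y$ if $j \geq 2$. The steps of $Y$ are the elements of $Z = \{(s,t) \in Y : (s+1,t) \notin Y \text{ and } (s,t+1) \notin Y\}$; the number of steps is $|Z|$ (equivalently, the number of distinct row lengths). A generalized rectangle in $Y$ is a set $R = S \times T$ with $S \subseteq [r]$, $T \subseteq [c]$ and $R \subseteq Y$; it uses the rows in $S$ and the columns in $T$. A set $C$ of generalized rectangles covers $Y$ if $Y = \bigcup_{R \in C} R$. -}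

module Defs where

open import Data.Nat using (ℕ; suc; _<?_)
open import Data.Bool using (Bool; true; false; _∧_; not; if_then_else_)
open import Data.Fin using (Fin; toℕ; fromℕ<)
open import Data.Fin.Subset using (Subset; _∈_)
open import Data.Fin.Subset.Properties using (_∈?_)
open import Data.List using (List; length; filter; map; allFin)
open import Data.Nat.ListAction using (sum)
open import Data.List.Relation.Unary.All using (All)
open import Data.List.Relation.Unary.Any using (Any)
open import Data.Product using (_×_; proj₁; proj₂)
open import Relation.Nullary using (yes; no)
open import Relation.Binary.PropositionalEquality using (_≡_)

-- A subset of [r] × [c] (0-indexed: Fin r × Fin c), given by its
-- characteristic function.
Diagram : ℕ → ℕ → Set
Diagram r c = Fin r → Fin c → Bool

-- Membership with natural-number indices; out of range means "not in Y".
at : ∀ {r c} → Diagram r c → ℕ → ℕ → Bool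
at {r} {c} Y i j with i <? r | j <? c
... | yes p | yes q = Y (fromℕ< p) (fromℕ< q)
... | _     | _     = false

IsYoung : ∀ {r c} → Diagram r c → Set
IsYoung Y = (∀ i j → at Y (suc i) j ≡ true → at Y i j ≡ true)
          × (∀ i j → at Y i (suc j) ≡ true → at Y i j ≡ true)

isStep : ∀ {r c} → Diagram r c → Fin r → Fin c → Bool
isStep Y s t = Y s t ∧ not (at Y (suc (toℕ s)) (toℕ t)) ∧ not (at Y (toℕ s) (suc (toℕ t)))

steps : ∀ {r c} → Diagram r c → ℕ
steps {r} {c} Y =
  sum (map (λ s → sum (map (λ t → if isStep Y s t then 1 else 0) (allFin c))) (allFin r))

Rect : ℕ → ℕ → Set
Rect r c = Subset r × Subset c

RectIn : ∀ {r c} → Diagram r c → Rect r c → Set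
RectIn Y R = ∀ i j → i ∈ proj₁ R → j ∈ proj₂ R → Y i j ≡ true

Covers : ∀ {r c} → Diagram r c → List (Rect r c) → Set
Covers Y C = All (RectIn Y) C
           × (∀ i j → Y i j ≡ true → Any (λ R → i ∈ proj₁ R × j ∈ proj₂ R) C)

rowUse : ∀ {r c} → Fin r → List (Rect r c) → ℕ
rowUse i C = length (filter (λ R → i ∈? proj₁ R) C)

colUse : ∀ {r c} → Fin c → List (Rect r c) → ℕ
colUse j C = length (filter (λ R → j ∈? proj₂ R) C)

module Submission where

-- Call a row a step row if the next row is shorter; the steps of Y sit one in each step row.  Give
-- row i the level "number of step rows above i", and column j the number of step rows it meets.
-- Then (i, j) ∈ Y iff level i < level j, so Y is the pullback of the staircase {p < q} on s + 1
-- points (s the number of steps).  Conversely, row 0 and the rows just below step rows, against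
-- the last columns of the step rows, cut a copy of that staircase out of Y.  Both directions
-- therefore reduce to covering the pairs p < q of n points by rectangles I × J with I < J, every
-- point lying in at most a of the sets I and b of the sets J, which is possible iff
-- n ≤ C(a + b, a).  Gluing covers for (a, b + 1) on [0, n₁) and for (a + 1, b) on [n₁, n) with the
-- rectangle [0, n₁) × [n₁, n) gives the construction.  Conversely, cut at the last s such that the
-- points below s still have row degree ≤ a inside [0, s): then the points from s on have column
-- degree ≤ b inside, and Pascal's rule bounds n.

open import Defs
open import Data.Nat
  using (ℕ; zero; suc; _+_; _∸_; _*_; _≤_; _<_; z≤n; s≤s; s≤s⁻¹; z<s; s<s; s<s⁻¹; _<ᵇ_; _≤?_; _<?_)
open import Data.Nat.Properties
open import Data.Nat.Combinatorics using (_C_; nCk+nC[k+1]≡[n+1]C[k+1]; nCn≡1)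
open import Data.Bool using (Bool; true; false; _∧_; not; if_then_else_)
open import Data.Bool.Properties using (T-≡)
open import Data.List using (List; []; _∷_; _++_; map; length; filter; allFin; tabulate)
open import Data.Nat.ListAction using (sum)
open import Data.Fin as Fin using (Fin; toℕ; fromℕ<)
open import Data.Fin.Properties using (toℕ<n; fromℕ<-toℕ)
open import Data.Fin.Subset using (Subset; _∈_)
open import Data.Fin.Subset.Properties using (_∈?_)
open import Data.Vec as Vec using (_∷_; lookup)
open import Data.Vec.Properties using (lookup∘tabulate; []=⇒lookup; lookup⇒[]=)
open import Data.List.Properties using (map-++; map-∘; map-tabulate)
import Data.List.Relation.Unary.All.Properties as All
import Data.List.Relation.Unary.Any.Properties as Any
open import Data.List.Relation.Unary.All as All using (All; []; _∷_)
open import Data.List.Relation.Unary.Any as Any using (Any; here; there)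
open import Data.Product using (Σ; ∃; _×_; _,_; proj₁; proj₂)
open import Data.Sum using (_⊎_; inj₁; inj₂)
open import Data.Empty using (⊥; ⊥-elim)
open import Function using (_∘_)
open import Function.Bundles using (_⇔_; mk⇔; Equivalence)
open import Relation.Nullary using (Dec; yes; no; ¬_; does)
open import Relation.Unary using (Decidable)
open import Relation.Nullary.Decidable using (_×-dec_)
open import Relation.Binary.PropositionalEquality
open import Algebra.Properties.CommutativeSemigroup +-commutativeSemigroup using (interchange)
import Data.Bool.Properties as Bool

∧-true⁻ˡ : ∀ {a b} → a ∧ b ≡ true → a ≡ true
∧-true⁻ˡ {true} _ = refl

∧-true⁻ʳ : ∀ {a b} → a ∧ b ≡ true → b ≡ true
∧-true⁻ʳ {true} e = e

∧-true : ∀ {a b} → a ≡ true → b ≡ true → a ∧ b ≡ true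
∧-true refl refl = refl

not-true⁻ : ∀ {a} → not a ≡ true → a ≡ false
not-true⁻ {false} _ = refl

true≢false : ∀ {a} → a ≡ true → a ≡ false → ⊥
true≢false refl ()

<ᵇ-true⁻ : ∀ {m n} → (m <ᵇ n) ≡ true → m < n
<ᵇ-true⁻ {m} {n} e = <ᵇ⇒< m n (Equivalence.from T-≡ e)

<ᵇ-true : ∀ {m n} → m < n → (m <ᵇ n) ≡ true
<ᵇ-true m<n = Equivalence.to T-≡ (<⇒<ᵇ m<n)

<ᵇ-false : ∀ {m n} → n ≤ m → (m <ᵇ n) ≡ false
<ᵇ-false {m} {n} n≤m with m <ᵇ n in e
... | true  = ⊥-elim (<⇒≱ (<ᵇ-true⁻ e) n≤m)
... | false = refl

<ᵇ-false⁻ : ∀ {m n} → (m <ᵇ n) ≡ false → n ≤ m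
<ᵇ-false⁻ {m} {n} e with m <? n
... | yes m<n = ⊥-elim (true≢false (<ᵇ-true m<n) e)
... | no m≮n = ≮⇒≥ m≮n

not-<ᵇ : ∀ m n → not (m <ᵇ n) ≡ (n <ᵇ suc m)
not-<ᵇ zero    zero    = refl
not-<ᵇ zero    (suc n) = refl
not-<ᵇ (suc m) zero    = refl
not-<ᵇ (suc m) (suc n) = not-<ᵇ m n

twice : ∀ k → 2 * k ≡ k + k
twice k = cong (k +_) (+-identityʳ k)

∸1< : ∀ {m} → 0 < m → m ∸ 1 < m
∸1< {suc m} _ = ≤-refl

∸1<⇒≤ : ∀ {m n} → 0 < m → m ∸ 1 < n → m ≤ n
∸1<⇒≤ {suc m} _ lt = lt

monotone-step : ∀ (f : ℕ → ℕ) → (∀ i → f i ≤ f (suc i)) → ∀ {i j} → i ≤ j → f i ≤ f j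
monotone-step f step {i} {zero}  z≤n = ≤-refl
monotone-step f step {i} {suc j} i≤1+j with m≤n⇒m<n∨m≡n i≤1+j
... | inj₂ refl = ≤-refl
... | inj₁ i<1+j = ≤-trans (monotone-step f step (s≤s⁻¹ i<1+j)) (step j)

antitone-step : ∀ (f : ℕ → ℕ) → (∀ i → f (suc i) ≤ f i) → ∀ {i j} → i ≤ j → f j ≤ f i
antitone-step f step {i} {zero}  z≤n = ≤-refl
antitone-step f step {i} {suc j} i≤1+j with m≤n⇒m<n∨m≡n i≤1+j
... | inj₂ refl = ≤-refl
... | inj₁ i<1+j = ≤-trans (step j) (antitone-step f step (s≤s⁻¹ i<1+j))

indicator : Bool → ℕ
indicator true  = 1
indicator false = 0

if-indicator : ∀ b → (if b then 1 else 0) ≡ indicator b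
if-indicator true  = refl
if-indicator false = refl

indicator≤1 : ∀ b → indicator b ≤ 1
indicator≤1 true  = ≤-refl
indicator≤1 false = z≤n

indicator-mono : ∀ {a b} → (a ≡ true → b ≡ true) → indicator a ≤ indicator b
indicator-mono {true}  a⇒b rewrite a⇒b refl = ≤-refl
indicator-mono {false} _ = z≤n

module _ {A : Set} where

  count : (A → Bool) → List A → ℕ
  count p []       = 0
  count p (x ∷ xs) = indicator (p x) + count p xs

  count-ext : ∀ {p q} xs → (∀ x → p x ≡ q x) → count p xs ≡ count q xs
  count-ext []       p≗q = refl
  count-ext (x ∷ xs) p≗q = cong₂ _+_ (cong indicator (p≗q x)) (count-ext xs p≗q)

  count-none : ∀ {p} xs → (∀ x → p x ≡ false) → count p xs ≡ 0
  count-none []       _     = refl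
  count-none (x ∷ xs) none rewrite none x = count-none xs none

  count-mono : ∀ {p q} xs → (∀ x → p x ≡ true → q x ≡ true) → count p xs ≤ count q xs
  count-mono []       p⇒q = z≤n
  count-mono (x ∷ xs) p⇒q = +-mono-≤ (indicator-mono (p⇒q x)) (count-mono xs p⇒q)

  count-++ : ∀ p xs ys → count p (xs ++ ys) ≡ count p xs + count p ys
  count-++ p []       ys = refl
  count-++ p (x ∷ xs) ys =
    trans (cong (indicator (p x) +_) (count-++ p xs ys)) (sym (+-assoc (indicator (p x)) _ _))

  count-positive : ∀ {p} xs → 0 < count p xs → Any (λ x → p x ≡ true) xs
  count-positive {p} (x ∷ xs) pos with p x in e
  ... | true  = here e
  ... | false = there (count-positive xs pos)

  count-witness : ∀ {p} xs → Any (λ x → p x ≡ true) xs → 0 < count p xs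
  count-witness (x ∷ xs) (here e) rewrite e = s≤s z≤n
  count-witness {p} (x ∷ xs) (there w) = ≤-trans (count-witness xs w) (m≤n+m _ (indicator (p x)))

  count-saturated : ∀ {p q} xs → (∀ x → p x ≡ true → q x ≡ true) → count q xs ≤ count p xs →
                    All (λ x → q x ≡ true → p x ≡ true) xs
  count-saturated []       p⇒q le = []
  count-saturated {p} {q} (x ∷ xs) p⇒q le with p x in ep | q x in eq
  ... | true  | true  = (λ _ → ep) ∷ count-saturated xs p⇒q (s≤s⁻¹ le)
  ... | true  | false = ⊥-elim (true≢false (p⇒q x ep) eq)
  ... | false | false = (λ e → ⊥-elim (true≢false e eq)) ∷ count-saturated xs p⇒q le
  ... | false | true  = ⊥-elim (<⇒≱ (s≤s (count-mono xs p⇒q)) le)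

count-map : ∀ {A B : Set} (p : B → Bool) (f : A → B) xs → count p (map f xs) ≡ count (p ∘ f) xs
count-map p f []       = refl
count-map p f (x ∷ xs) = cong (indicator (p (f x)) +_) (count-map p f xs)

sumBelow : ℕ → (ℕ → ℕ) → ℕ
sumBelow zero    f = 0
sumBelow (suc n) f = f 0 + sumBelow n (f ∘ suc)

countBelow : ℕ → (ℕ → Bool) → ℕ
countBelow n p = sumBelow n (indicator ∘ p)

sumBelow-ext : ∀ {f g} n → (∀ i → i < n → f i ≡ g i) → sumBelow n f ≡ sumBelow n g
sumBelow-ext zero    f≗g = refl
sumBelow-ext (suc n) f≗g = cong₂ _+_ (f≗g 0 z<s) (sumBelow-ext n (λ i i<n → f≗g (suc i) (s<s i<n)))

sumBelow-+ : ∀ n f g → sumBelow n (λ i → f i + g i) ≡ sumBelow n f + sumBelow n g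
sumBelow-+ zero    f g = refl
sumBelow-+ (suc n) f g = trans (cong (f 0 + g 0 +_) (sumBelow-+ n (f ∘ suc) (g ∘ suc)))
                               (interchange (f 0) (g 0) _ _)

countBelow-split : ∀ n (p q : ℕ → Bool) →
                   countBelow n p ≡ countBelow n (λ i → p i ∧ q i) + countBelow n (λ i → p i ∧ not (q i))
countBelow-split n p q = trans (sumBelow-ext n (λ i _ → split (p i) (q i)))
                               (sumBelow-+ n (λ i → indicator (p i ∧ q i)) (λ i → indicator (p i ∧ not (q i))))
  where
  split : ∀ a b → indicator a ≡ indicator (a ∧ b) + indicator (a ∧ not b)
  split true  true  = refl
  split true  false = refl
  split false _     = refl

sumBelow-zero : ∀ n {f} → (∀ i → i < n → f i ≡ 0) → sumBelow n f ≡ 0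
sumBelow-zero zero    vanish = refl
sumBelow-zero (suc n) vanish rewrite vanish 0 z<s = sumBelow-zero n (λ i i<n → vanish (suc i) (s<s i<n))

countBelow-none : ∀ n {p} → (∀ i → i < n → p i ≡ false) → countBelow n p ≡ 0
countBelow-none n none = sumBelow-zero n (λ i i<n → cong indicator (none i i<n))

countBelow-≤1 : ∀ n p → (∀ {i j} → p i ≡ true → p j ≡ true → ¬ i < j) → countBelow n p ≤ 1
countBelow-≤1 zero    p single = z≤n
countBelow-≤1 (suc n) p single with p 0 in p0
... | false = countBelow-≤1 n (p ∘ suc) (λ pi pj i<j → single pi pj (s<s i<j))
... | true  = ≤-reflexive (cong suc (countBelow-none n (λ i _ → nothing-after i)))
  where
  nothing-after : ∀ i → p (suc i) ≡ false
  nothing-after i with p (suc i) in pi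
  ... | true  = ⊥-elim (single p0 pi z<s)
  ... | false = refl

sumBelow-mono : ∀ {f g} n → (∀ i → i < n → f i ≤ g i) → sumBelow n f ≤ sumBelow n g
sumBelow-mono zero    f≤g = z≤n
sumBelow-mono (suc n) f≤g = +-mono-≤ (f≤g 0 z<s) (sumBelow-mono n (λ i i<n → f≤g (suc i) (s<s i<n)))

sumBelow-suc : ∀ n f → sumBelow (suc n) f ≡ sumBelow n f + f n
sumBelow-suc zero    f = +-comm (f 0) 0
sumBelow-suc (suc n) f = trans (cong (f 0 +_) (sumBelow-suc n (f ∘ suc))) (sym (+-assoc (f 0) _ _))

countBelow≤ : ∀ n p → countBelow n p ≤ n
countBelow≤ zero    p = z≤n
countBelow≤ (suc n) p = +-mono-≤ (indicator≤1 (p 0)) (countBelow≤ n (p ∘ suc))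

sumBelow-single : ∀ n k f → k < n → (∀ i → i ≢ k → f i ≡ 0) → sumBelow n f ≡ f k
sumBelow-single (suc n) zero f _ elsewhere =
  trans (cong (f 0 +_) (sumBelow-zero n (λ i _ → elsewhere (suc i) (λ ())))) (+-identityʳ (f 0))
sumBelow-single (suc n) (suc k) f k<n elsewhere rewrite elsewhere 0 (λ ()) =
  sumBelow-single n k (f ∘ suc) (s<s⁻¹ k<n) (λ i i≢k → elsewhere (suc i) (i≢k ∘ suc-injective))

DownClosed : (ℕ → Bool) → Set
DownClosed p = ∀ j → p (suc j) ≡ true → p j ≡ true

downClosed-false : ∀ {p} → DownClosed p → p 0 ≡ false → ∀ j → p j ≡ false
downClosed-false closed p0 zero = p0
downClosed-false {p} closed p0 (suc j) with p (suc j) in e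
... | true  = ⊥-elim (true≢false (closed j e) (downClosed-false closed p0 j))
... | false = refl

downClosed-initial : ∀ n p → DownClosed p → (∀ j → n ≤ j → p j ≡ false) → ∀ j → p j ≡ (j <ᵇ countBelow n p)
downClosed-initial zero p closed vanish j = vanish j z≤n
downClosed-initial (suc n) p closed vanish j with p 0 in p0
... | false rewrite countBelow-none n (λ i _ → downClosed-false closed p0 (suc i)) =
  downClosed-false closed p0 j
downClosed-initial (suc n) p closed vanish zero    | true = p0
downClosed-initial (suc n) p closed vanish (suc j) | true =
  downClosed-initial n (p ∘ suc) (closed ∘ suc) (λ i n≤i → vanish (suc i) (s≤s n≤i)) j

lastBefore : ∀ {Q : ℕ → Set} → Decidable Q → ¬ Q 0 → ∀ N → ∃ λ s → ¬ Q s × (s ≡ N ⊎ Q (suc s))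
lastBefore Q? ¬Q0 zero = 0 , ¬Q0 , inj₁ refl
lastBefore Q? ¬Q0 (suc N) with lastBefore Q? ¬Q0 N
... | s , ¬Qs , inj₂ Qs+1 = s , ¬Qs , inj₂ Qs+1
... | s , ¬Qs , inj₁ refl with Q? (suc s)
...   | yes Qs+1 = s , ¬Qs , inj₂ Qs+1
...   | no ¬Qs+1 = suc s , ¬Qs+1 , inj₁ refl

sum-allFin : ∀ n (f : Fin n → ℕ) g → (∀ i → f i ≡ g (toℕ i)) → sum (map f (allFin n)) ≡ sumBelow n g
sum-allFin n f g f≗g = trans (cong sum (map-tabulate (λ i → i) f)) (sum-tabulate n f g f≗g)
  where
  sum-tabulate : ∀ n (f : Fin n → ℕ) g → (∀ i → f i ≡ g (toℕ i)) → sum (tabulate f) ≡ sumBelow n g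
  sum-tabulate zero    f g f≗g = refl
  sum-tabulate (suc n) f g f≗g = cong₂ _+_ (f≗g Fin.zero) (sum-tabulate n (f ∘ Fin.suc) (g ∘ suc) (f≗g ∘ Fin.suc))

pascal : ∀ a b → (suc a + suc b) C suc a ≡ (a + suc b) C a + (suc a + b) C suc a
pascal a b = begin
  (suc a + suc b) C suc a                 ≡⟨ sym (nCk+nC[k+1]≡[n+1]C[k+1] (a + suc b) a) ⟩
  (a + suc b) C a + (a + suc b) C suc a   ≡⟨ cong (λ n → (a + suc b) C a + n C suc a) (+-suc a b) ⟩
  (a + suc b) C a + (suc a + b) C suc a   ∎
  where open ≡-Reasoning

module StaircaseBound {R : Set} (rows cols : R → ℕ → Bool) (Cs : List R) (N : ℕ) where

  _⊆_ : (ℕ → Bool) → (ℕ → Bool) → Set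
  M₁ ⊆ M = ∀ i → M₁ i ≡ true → M i ≡ true

  meets? : (M S : ℕ → Bool) → Dec (∃ λ p → p < N × M p ∧ S p ≡ true)
  meets? M S = anyUpTo? (λ p → M p ∧ S p Bool.≟ true) N

  meets : (ℕ → Bool) → (ℕ → Bool) → Bool
  meets M S = does (meets? M S)

  meets-intro : ∀ M S {p} → p < N → M p ≡ true → S p ≡ true → meets M S ≡ true
  meets-intro M S {p} p<N Mp Sp with meets? M S
  ... | yes _ = refl
  ... | no ∄  = ⊥-elim (∄ (p , p<N , ∧-true Mp Sp))

  meets-elim : ∀ M S → meets M S ≡ true → ∃ λ p → p < N × M p ≡ true × S p ≡ true
  meets-elim M S e with meets? M S
  ... | yes (p , p<N , MSp) = p , p<N , ∧-true⁻ˡ MSp , ∧-true⁻ʳ MSp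
  ... | no _ = ⊥-elim (true≢false e refl)

  meets-mono : ∀ {M₁ M} S → M₁ ⊆ M → meets M₁ S ≡ true → meets M S ≡ true
  meets-mono {M₁} {M} S M₁⊆M e with meets-elim M₁ S e
  ... | p , p<N , M₁p , Sp = meets-intro M S p<N (M₁⊆M p M₁p) Sp

  -- Only rectangles reaching M on the other side are counted, so that degrees can only drop
  -- when M shrinks.
  rowDegree : (ℕ → Bool) → ℕ → ℕ
  rowDegree M i = count (λ x → rows x i ∧ meets M (cols x)) Cs

  colDegree : (ℕ → Bool) → ℕ → ℕ
  colDegree M j = count (λ x → cols x j ∧ meets M (rows x)) Cs

  RowDegree≤ : (ℕ → Bool) → ℕ → Set
  RowDegree≤ M a = ∀ i → M i ≡ true → rowDegree M i ≤ a

  ColDegree≤ : (ℕ → Bool) → ℕ → Set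
  ColDegree≤ M b = ∀ j → M j ≡ true → colDegree M j ≤ b

  SeparatedOn : (ℕ → Bool) → R → Set
  SeparatedOn M x = ∀ {i j} → M i ≡ true → M j ≡ true → rows x i ≡ true → cols x j ≡ true → i < j

  record Staircase (M : ℕ → Bool) : Set where
    field
      bounded   : ∀ i → M i ≡ true → i < N
      separated : All (SeparatedOn M) Cs
      covered   : ∀ {i j} → M i ≡ true → M j ≡ true → i < j →
                  Any (λ x → rows x i ≡ true × cols x j ≡ true) Cs

  staircase-⊆ : ∀ {M₁ M} → M₁ ⊆ M → Staircase M → Staircase M₁
  staircase-⊆ M₁⊆M st = record
    { bounded   = λ i M₁i → bounded i (M₁⊆M i M₁i)
    ; separated = All.map (λ sep {i} {j} M₁i M₁j → sep (M₁⊆M i M₁i) (M₁⊆M j M₁j)) separated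
    ; covered   = λ M₁i M₁j → covered (M₁⊆M _ M₁i) (M₁⊆M _ M₁j)
    }
    where open Staircase st

  rowDegree≤-⊆ : ∀ {M₁ M a} → M₁ ⊆ M → RowDegree≤ M a → RowDegree≤ M₁ a
  rowDegree≤-⊆ M₁⊆M deg i M₁i =
    ≤-trans (count-mono Cs (λ x e → ∧-true (∧-true⁻ˡ e) (meets-mono (cols x) M₁⊆M (∧-true⁻ʳ e))))
            (deg i (M₁⊆M i M₁i))

  colDegree≤-⊆ : ∀ {M₁ M b} → M₁ ⊆ M → ColDegree≤ M b → ColDegree≤ M₁ b
  colDegree≤-⊆ M₁⊆M deg j M₁j =
    ≤-trans (count-mono Cs (λ x e → ∧-true (∧-true⁻ˡ e) (meets-mono (rows x) M₁⊆M (∧-true⁻ʳ e))))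
            (deg j (M₁⊆M j M₁j))

  below above : ℕ → (ℕ → Bool) → ℕ → Bool
  below s M i = M i ∧ (i <ᵇ s)
  above s M i = M i ∧ not (i <ᵇ s)

  below⊆ : ∀ s M → below s M ⊆ M
  below⊆ s M i = ∧-true⁻ˡ

  above⊆ : ∀ s M → above s M ⊆ M
  above⊆ s M i = ∧-true⁻ˡ

  meets-below : ∀ t M S → meets (below t M) S ≡ true → ∃ λ j → j < t × M j ≡ true × S j ≡ true
  meets-below t M S e with meets-elim (below t M) S e
  ... | j , _ , belowj , Sj = j , <ᵇ-true⁻ (∧-true⁻ʳ belowj) , ∧-true⁻ˡ belowj , Sj

  meets-above : ∀ s M S → meets (above s M) S ≡ true → ∃ λ i → s ≤ i × M i ≡ true × S i ≡ true
  meets-above s M S e with meets-elim (above s M) S e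
  ... | i , _ , abovei , Si = i , <ᵇ-false⁻ (not-true⁻ (∧-true⁻ʳ abovei)) , ∧-true⁻ˡ abovei , Si

  size : (ℕ → Bool) → ℕ
  size M = countBelow N M

  size-split : ∀ s M → size M ≡ size (below s M) + size (above s M)
  size-split s M = countBelow-split N M (_<ᵇ s)

  Overloaded : (ℕ → Bool) → ℕ → ℕ → Set
  Overloaded M a s = ∃ λ i → i < s × (M i ≡ true × a < rowDegree (below s M) i)

  overloaded? : ∀ M a → Decidable (Overloaded M a)
  overloaded? M a s = anyUpTo? (λ i → (M i Bool.≟ true) ×-dec (a <? rowDegree (below s M) i)) s

  ¬overloaded : ∀ {M a s} → ¬ Overloaded M a s → RowDegree≤ (below s M) a
  ¬overloaded {M} ¬over i belowi =
    ≮⇒≥ (λ a< → ¬over (i , <ᵇ-true⁻ (∧-true⁻ʳ {M i} belowi) , ∧-true⁻ˡ belowi , a<))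

  module _ {M : ℕ → Bool} (st : Staircase M) where
    open Staircase st

    rowDegree-positive : ∀ {i j} → M i ≡ true → M j ≡ true → i < j → 0 < rowDegree M i
    rowDegree-positive {i} {j} Mi Mj i<j = count-witness {p = λ x → rows x i ∧ meets M (cols x)} Cs
      (Any.map (λ {x} (ri , cj) → ∧-true ri (meets-intro M (cols x) (bounded j Mj) Mj cj)) (covered Mi Mj i<j))

    colDegree-positive : ∀ {i j} → M i ≡ true → M j ≡ true → i < j → 0 < colDegree M j
    colDegree-positive {i} {j} Mi Mj i<j = count-witness {p = λ x → cols x j ∧ meets M (rows x)} Cs
      (Any.map (λ {x} (ri , cj) → ∧-true cj (meets-intro M (rows x) (bounded i Mi) Mi ri)) (covered Mi Mj i<j))

    ¬straddle : ∀ {x s} → SeparatedOn M x →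
                meets (above s M) (rows x) ≡ true → meets (below (suc s) M) (cols x) ≡ true → ⊥
    ¬straddle {x} {s} sep toAbove toBelow
      with meets-above s M (rows x) toAbove | meets-below (suc s) M (cols x) toBelow
    ... | i , s≤i , Mi , ri | j , j<1+s , Mj , cj = <⇒≱ (sep Mi Mj ri cj) (≤-trans (s≤s⁻¹ j<1+s) s≤i)

    overloaded-row : ∀ {a s} → RowDegree≤ M (suc a) → Overloaded M a (suc s) →
      ∃ λ i → i < s × M i ≡ true ×
        All (λ x → rows x i ∧ meets M (cols x) ≡ true → meets (below (suc s) M) (cols x) ≡ true) Cs
    overloaded-row {s = s} deg (i , _ , Mi , a<deg) = i , i<s , Mi , All.map (∧-true⁻ʳ ∘_) saturated
      where
      saturated : All (λ x → rows x i ∧ meets M (cols x) ≡ true →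
                             rows x i ∧ meets (below (suc s) M) (cols x) ≡ true) Cs
      saturated = count-saturated Cs
        (λ x e → ∧-true (∧-true⁻ˡ e) (meets-mono (cols x) (below⊆ (suc s) M) (∧-true⁻ʳ e)))
        (≤-trans (deg i Mi) a<deg)
      i<s : i < s
      i<s with All.lookupAny separated (count-positive Cs (≤-trans z<s a<deg))
      ... | sep , e with meets-below (suc s) M _ (∧-true⁻ʳ e)
      ... | j , j<1+s , Mj , cj = <-≤-trans (sep Mi Mj (∧-true⁻ˡ e) cj) (s≤s⁻¹ j<1+s)

    -- A column above s at full degree b + 1 sees only rectangles whose rows reach above s, and an
    -- overloaded row below s + 1 only rectangles whose columns stay below s + 1; the rectangle
    -- covering that row and column would have to do both.
    above-colDegree : ∀ {a b} → RowDegree≤ M (suc a) → ColDegree≤ M (suc b) →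
                      ∀ s → s ≡ N ⊎ Overloaded M a (suc s) → ColDegree≤ (above s M) b
    above-colDegree {a} {b} rowDeg colDeg s end j abovej with colDegree (above s M) j ≤? b
    ... | yes ok = ok
    ... | no exceeds = ⊥-elim (impossible end)
      where
      Mj : M j ≡ true
      Mj = ∧-true⁻ˡ abovej
      s≤j : s ≤ j
      s≤j = <ᵇ-false⁻ (not-true⁻ (∧-true⁻ʳ {M j} abovej))
      reachesAbove : All (λ x → cols x j ∧ meets M (rows x) ≡ true → meets (above s M) (rows x) ≡ true) Cs
      reachesAbove = All.map (∧-true⁻ʳ ∘_) (count-saturated Cs
        (λ x e → ∧-true (∧-true⁻ˡ e) (meets-mono (rows x) (above⊆ s M) (∧-true⁻ʳ e)))
        (≤-trans (colDeg j Mj) (≰⇒> exceeds)))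
      impossible : s ≡ N ⊎ Overloaded M a (suc s) → ⊥
      impossible (inj₁ refl) = <⇒≱ (bounded j Mj) s≤j
      impossible (inj₂ over) with overloaded-row rowDeg over
      ... | i , i<s , Mi , reachesBelow
        with All.lookupAny (All.zip (separated , All.zip (reachesBelow , reachesAbove)))
                           (covered Mi Mj (<-≤-trans i<s s≤j))
      ... | (sep , toBelow , toAbove) , ri , cj =
        ¬straddle sep (toAbove (∧-true cj (meets-intro M _ (bounded i Mi) Mi ri)))
                      (toBelow (∧-true ri (meets-intro M _ (bounded j Mj) Mj cj)))

  size≤binomial : ∀ a b {M} → Staircase M → RowDegree≤ M a → ColDegree≤ M b → size M ≤ (a + b) C a
  size≤binomial zero b {M} st rowDeg colDeg =
    countBelow-≤1 N M (λ Mi Mj i<j → <⇒≱ (rowDegree-positive st Mi Mj i<j) (rowDeg _ Mi))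
  size≤binomial (suc a) zero {M} st rowDeg colDeg rewrite +-identityʳ a | nCn≡1 (suc a) =
    countBelow-≤1 N M (λ Mi Mj i<j → <⇒≱ (colDegree-positive st Mi Mj i<j) (colDeg _ Mj))
  size≤binomial (suc a) (suc b) {M} st rowDeg colDeg
    with lastBefore (overloaded? M a) (λ ()) N
  ... | s , ¬over , end = begin
    size M                                  ≡⟨ size-split s M ⟩
    size (below s M) + size (above s M)     ≤⟨ +-mono-≤ left right ⟩
    (a + suc b) C a + (suc a + b) C suc a   ≡⟨ pascal a b ⟨
    (suc a + suc b) C suc a                 ∎
    where
    open ≤-Reasoning
    left : size (below s M) ≤ (a + suc b) C a
    left = size≤binomial a (suc b) (staircase-⊆ (below⊆ s M) st)
             (¬overloaded ¬over) (colDegree≤-⊆ (below⊆ s M) colDeg)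
    right : size (above s M) ≤ (suc a + b) C suc a
    right = size≤binomial (suc a) b (staircase-⊆ (above⊆ s M) st)
              (rowDegree≤-⊆ (above⊆ s M) rowDeg) (above-colDegree st rowDeg colDeg s end)

Supported : ℕ → (ℕ → Bool) → Set
Supported n P = ∀ i → P i ≡ true → i < n

occurrences : ℕ → List (ℕ → Bool) → ℕ
occurrences i = count (λ P → P i)

occurrences-unsupported : ∀ {n i} Ps → All (Supported n) Ps → n ≤ i → occurrences i Ps ≡ 0
occurrences-unsupported [] [] n≤i = refl
occurrences-unsupported {i = i} (P ∷ Ps) (supp ∷ supps) n≤i with P i in e
... | true  = ⊥-elim (<⇒≱ (supp i e) n≤i)
... | false = occurrences-unsupported Ps supps n≤i

shift : ℕ → (ℕ → Bool) → ℕ → Bool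
shift k P i = not (i <ᵇ k) ∧ P (i ∸ k)

shift-below : ∀ k {i} P → i < k → shift k P i ≡ false
shift-below k P i<k rewrite <ᵇ-true i<k = refl

shift-above : ∀ k {i} P → k ≤ i → shift k P i ≡ P (i ∸ k)
shift-above k P k≤i rewrite <ᵇ-false k≤i = refl

shift-true⁻ : ∀ k {i} P → shift k P i ≡ true → k ≤ i × P (i ∸ k) ≡ true
shift-true⁻ k {i} P e = <ᵇ-false⁻ (not-true⁻ (∧-true⁻ˡ e)) , ∧-true⁻ʳ {not (i <ᵇ k)} e

shift-true : ∀ k {i} P → k ≤ i → P (i ∸ k) ≡ true → shift k P i ≡ true
shift-true k P k≤i e = trans (shift-above k P k≤i) e

shift-supported : ∀ {k n P} → Supported n P → Supported (k + n) (shift k P)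
shift-supported {k} {n} {P} supp i e with shift-true⁻ k P e
... | k≤i , Pi-k = subst (_< k + n) (m+[n∸m]≡n k≤i) (+-monoʳ-< k (supp (i ∸ k) Pi-k))

occurrences-glue-below : ∀ {k i} Ps Qs → i < k → occurrences i (Ps ++ map (shift k) Qs) ≡ occurrences i Ps
occurrences-glue-below {k} {i} Ps Qs i<k = begin
  occurrences i (Ps ++ map (shift k) Qs)                 ≡⟨ count-++ _ Ps (map (shift k) Qs) ⟩
  occurrences i Ps + occurrences i (map (shift k) Qs)    ≡⟨ cong (occurrences i Ps +_) shifted-away ⟩
  occurrences i Ps + 0                                   ≡⟨ +-identityʳ _ ⟩
  occurrences i Ps                                       ∎
  where
  open ≡-Reasoning
  shifted-away : occurrences i (map (shift k) Qs) ≡ 0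
  shifted-away = trans (count-map _ (shift k) Qs) (count-none Qs (λ Q → shift-below k Q i<k))

occurrences-glue-above : ∀ {k i} Ps Qs → k ≤ i → All (Supported k) Ps →
                         occurrences i (Ps ++ map (shift k) Qs) ≡ occurrences (i ∸ k) Qs
occurrences-glue-above {k} {i} Ps Qs k≤i supp = begin
  occurrences i (Ps ++ map (shift k) Qs)                 ≡⟨ count-++ _ Ps (map (shift k) Qs) ⟩
  occurrences i Ps + occurrences i (map (shift k) Qs)    ≡⟨ cong (_+ _) (occurrences-unsupported Ps supp k≤i) ⟩
  occurrences i (map (shift k) Qs)                       ≡⟨ count-map _ (shift k) Qs ⟩
  count (λ Q → shift k Q i) Qs                           ≡⟨ count-ext Qs (λ Q → shift-above k Q k≤i) ⟩
  occurrences (i ∸ k) Qs                                 ∎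
  where open ≡-Reasoning

Rectangleℕ : Set
Rectangleℕ = (ℕ → Bool) × (ℕ → Bool)

RowsBeforeCols : Rectangleℕ → Set
RowsBeforeCols (I , J) = ∀ {i j} → I i ≡ true → J j ≡ true → i < j

shiftRect : ℕ → Rectangleℕ → Rectangleℕ
shiftRect k (I , J) = shift k I , shift k J

shiftRect-rowsBeforeCols : ∀ k x → RowsBeforeCols x → RowsBeforeCols (shiftRect k x)
shiftRect-rowsBeforeCols k (I , J) sep {i} {j} Ii Jj with shift-true⁻ k I Ii | shift-true⁻ k J Jj
... | k≤i , I[i-k] | k≤j , J[j-k] =
  subst₂ _<_ (m+[n∸m]≡n k≤i) (m+[n∸m]≡n k≤j) (+-monoʳ-< k (sep I[i-k] J[j-k]))

map-proj₁-glue : ∀ k L₁ L₂ → map proj₁ (L₁ ++ map (shiftRect k) L₂) ≡ map proj₁ L₁ ++ map (shift k) (map proj₁ L₂)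
map-proj₁-glue k L₁ L₂ = trans (map-++ proj₁ L₁ _) (cong (map proj₁ L₁ ++_)
  (trans (sym (map-∘ {g = proj₁} {f = shiftRect k} L₂)) (map-∘ {g = shift k} {f = proj₁} L₂)))

map-proj₂-glue : ∀ k L₁ L₂ → map proj₂ (L₁ ++ map (shiftRect k) L₂) ≡ map proj₂ L₁ ++ map (shift k) (map proj₂ L₂)
map-proj₂-glue k L₁ L₂ = trans (map-++ proj₂ L₁ _) (cong (map proj₂ L₁ ++_)
  (trans (sym (map-∘ {g = proj₂} {f = shiftRect k} L₂)) (map-∘ {g = shift k} {f = proj₂} L₂)))

record StaircaseCover (a b n : ℕ) (L : List Rectangleℕ) : Set where
  field
    separated  : All RowsBeforeCols L
    rowsWithin : All (Supported n) (map proj₁ L)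
    colsWithin : All (Supported n) (map proj₂ L)
    covers     : ∀ {i j} → i < j → j < n → Any (λ x → proj₁ x i ≡ true × proj₂ x j ≡ true) L
    rowDegree≤ : ∀ i → occurrences i (map proj₁ L) ≤ a
    colDegree≤ : ∀ j → occurrences j (map proj₂ L) ≤ b

emptyCover : ∀ {a b n} → n ≤ 1 → StaircaseCover a b n []
emptyCover n≤1 = record
  { separated  = []
  ; rowsWithin = []
  ; colsWithin = []
  ; covers     = λ i<j j<n → ⊥-elim (n≮0 (<-≤-trans i<j (s≤s⁻¹ (≤-trans j<n n≤1))))
  ; rowDegree≤ = λ _ → z≤n
  ; colDegree≤ = λ _ → z≤n
  }

bridge : ℕ → ℕ → Rectangleℕ
bridge n₁ n = (_<ᵇ n₁) , (λ j → not (j <ᵇ n₁) ∧ (j <ᵇ n))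

bridge-rowsBeforeCols : ∀ n₁ n → RowsBeforeCols (bridge n₁ n)
bridge-rowsBeforeCols n₁ n {i} {j} i<n₁ Jj =
  <-≤-trans (<ᵇ-true⁻ {i} {n₁} i<n₁) (<ᵇ-false⁻ (not-true⁻ (∧-true⁻ˡ {not (j <ᵇ n₁)} Jj)))

bridge-rows : ∀ n₁ n₂ → Supported (n₁ + n₂) (proj₁ (bridge n₁ (n₁ + n₂)))
bridge-rows n₁ n₂ i i<n₁ = <-≤-trans (<ᵇ-true⁻ i<n₁) (m≤m+n n₁ n₂)

bridge-cols : ∀ n₁ n → Supported n (proj₂ (bridge n₁ n))
bridge-cols n₁ n j e = <ᵇ-true⁻ (∧-true⁻ʳ {not (j <ᵇ n₁)} e)

module _ {a b n₁ n₂ L₁ L₂} (left : StaircaseCover a (suc b) n₁ L₁) (right : StaircaseCover (suc a) b n₂ L₂) where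
  private
    module Lf = StaircaseCover left
    module Rt = StaircaseCover right

  glued : List Rectangleℕ
  glued = bridge n₁ (n₁ + n₂) ∷ L₁ ++ map (shiftRect n₁) L₂

  glued-covers : ∀ {i j} → i < j → j < n₁ + n₂ → Any (λ x → proj₁ x i ≡ true × proj₂ x j ≡ true) glued
  glued-covers {i} {j} i<j j<n with j <? n₁ | i <? n₁
  ... | yes j<n₁ | _        = there (Any.++⁺ˡ (Lf.covers i<j j<n₁))
  ... | no j≮n₁  | yes i<n₁ =
    here (<ᵇ-true i<n₁ , ∧-true {not (j <ᵇ n₁)} (cong not (<ᵇ-false (≮⇒≥ j≮n₁))) (<ᵇ-true j<n))
  ... | no j≮n₁  | no i≮n₁  = there (Any.++⁺ʳ L₁ (Any.map⁺ (Any.map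
          (λ {x} (Ii , Jj) → shift-true n₁ (proj₁ x) (≮⇒≥ i≮n₁) Ii , shift-true n₁ (proj₂ x) (≮⇒≥ j≮n₁) Jj)
          (Rt.covers (∸-monoˡ-< i<j (≮⇒≥ i≮n₁))
                     (subst (j ∸ n₁ <_) (m+n∸m≡n n₁ n₂) (∸-monoˡ-< j<n (≮⇒≥ j≮n₁)))))))

  glued-rowDegree≤ : ∀ i → occurrences i (map proj₁ glued) ≤ suc a
  glued-rowDegree≤ i rewrite map-proj₁-glue n₁ L₁ L₂ with i <? n₁
  ... | yes i<n₁ rewrite <ᵇ-true i<n₁ | occurrences-glue-below (map proj₁ L₁) (map proj₁ L₂) i<n₁ =
    s≤s (Lf.rowDegree≤ i)
  ... | no i≮n₁ rewrite <ᵇ-false (≮⇒≥ i≮n₁)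
                      | occurrences-glue-above (map proj₁ L₁) (map proj₁ L₂) (≮⇒≥ i≮n₁) Lf.rowsWithin =
    Rt.rowDegree≤ (i ∸ n₁)

  glued-colDegree≤ : ∀ j → occurrences j (map proj₂ glued) ≤ suc b
  glued-colDegree≤ j rewrite map-proj₂-glue n₁ L₁ L₂ with j <? n₁
  ... | yes j<n₁ rewrite <ᵇ-true j<n₁ | occurrences-glue-below (map proj₂ L₁) (map proj₂ L₂) j<n₁ =
    Lf.colDegree≤ j
  ... | no j≮n₁ rewrite <ᵇ-false (≮⇒≥ j≮n₁)
                      | occurrences-glue-above (map proj₂ L₁) (map proj₂ L₂) (≮⇒≥ j≮n₁) Lf.colsWithin =
    +-mono-≤ (indicator≤1 (j <ᵇ n₁ + n₂)) (Rt.colDegree≤ (j ∸ n₁))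

  glue : StaircaseCover (suc a) (suc b) (n₁ + n₂) glued
  glue = record
    { separated  = bridge-rowsBeforeCols n₁ (n₁ + n₂) ∷
                     All.++⁺ Lf.separated (All.map⁺ (All.map (shiftRect-rowsBeforeCols n₁ _) Rt.separated))
    ; rowsWithin = bridge-rows n₁ n₂ ∷ subst (All (Supported (n₁ + n₂))) (sym (map-proj₁-glue n₁ L₁ L₂))
                     (All.++⁺ (All.map widen Lf.rowsWithin) (All.map⁺ (All.map shift-supported Rt.rowsWithin)))
    ; colsWithin = bridge-cols n₁ (n₁ + n₂) ∷ subst (All (Supported (n₁ + n₂))) (sym (map-proj₂-glue n₁ L₁ L₂))
                     (All.++⁺ (All.map widen Lf.colsWithin) (All.map⁺ (All.map shift-supported Rt.colsWithin)))
    ; covers     = glued-covers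
    ; rowDegree≤ = glued-rowDegree≤
    ; colDegree≤ = glued-colDegree≤
    }
    where
    widen : ∀ {P} → Supported n₁ P → Supported (n₁ + n₂) P
    widen supp i Pi = <-≤-trans (supp i Pi) (m≤m+n n₁ n₂)

splitBelow : ∀ n c₁ c₂ → n ≤ c₁ + c₂ → ∃ λ n₁ → ∃ λ n₂ → n ≡ n₁ + n₂ × n₁ ≤ c₁ × n₂ ≤ c₂
splitBelow n c₁ c₂ n≤c with n ≤? c₁
... | yes n≤c₁ = n , 0 , sym (+-identityʳ n) , n≤c₁ , z≤n
... | no n≰c₁  = c₁ , n ∸ c₁ , sym (m+[n∸m]≡n (<⇒≤ (≰⇒> n≰c₁))) , ≤-refl , m≤n+o⇒m∸n≤o n c₁ n≤c

staircaseCover : ∀ a b n → n ≤ (a + b) C a → ∃ (StaircaseCover a b n)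
staircaseCover zero    b       n n≤1 = [] , emptyCover n≤1
staircaseCover (suc a) zero    n bound rewrite +-identityʳ a | nCn≡1 (suc a) = [] , emptyCover bound
staircaseCover (suc a) (suc b) n bound
  with splitBelow n ((a + suc b) C a) ((suc a + b) C suc a) (subst (n ≤_) (pascal a b) bound)
... | n₁ , n₂ , refl , n₁≤ , n₂≤ with staircaseCover a (suc b) n₁ n₁≤ | staircaseCover (suc a) b n₂ n₂≤
... | _ , left | _ , right = _ , glue left right

length-filter≡count : ∀ {A : Set} {P : A → Set} (P? : Decidable P) xs →
                      length (filter P? xs) ≡ count (λ x → does (P? x)) xs
length-filter≡count P? []       = refl
length-filter≡count P? (x ∷ xs) with does (P? x)
... | true  = cong suc (length-filter≡count P? xs)
... | false = length-filter≡count P? xs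

does-∈? : ∀ {n} (x : Fin n) S → does (x ∈? S) ≡ lookup S x
does-∈? Fin.zero    (true  ∷ S) = refl
does-∈? Fin.zero    (false ∷ S) = refl
does-∈? (Fin.suc x) (_ ∷ S)     = does-∈? x S

length-filter-∈? : ∀ {A : Set} {n} (side : A → Subset n) x xs →
                   length (filter (λ R → x ∈? side R) xs) ≡ count (λ R → lookup (side R) x) xs
length-filter-∈? side x xs = trans (length-filter≡count _ xs) (count-ext xs (λ R → does-∈? x (side R)))

∈-tabulate⁻ : ∀ {n} (h : Fin n → Bool) x → x ∈ Vec.tabulate h → h x ≡ true
∈-tabulate⁻ h x x∈ = trans (sym (lookup∘tabulate h x)) ([]=⇒lookup x∈)

∈-tabulate : ∀ {n} (h : Fin n → Bool) x → h x ≡ true → x ∈ Vec.tabulate h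
∈-tabulate h x hx = lookup⇒[]= x (Vec.tabulate h) (trans (lookup∘tabulate h x) hx)

_∈ᵇ_ : ∀ {n} → ℕ → Subset n → Bool
_∈ᵇ_ {n} i S with i <? n
... | yes i<n = lookup S (fromℕ< i<n)
... | no _    = false

∈ᵇ-inside : ∀ {n i} (S : Subset n) (i<n : i < n) → i ∈ᵇ S ≡ lookup S (fromℕ< i<n)
∈ᵇ-inside {n} {i} S i<n with i <? n
... | yes _   = refl
... | no i≮n = ⊥-elim (i≮n i<n)

∈ᵇ-outside : ∀ {n i} (S : Subset n) → n ≤ i → i ∈ᵇ S ≡ false
∈ᵇ-outside {n} {i} S n≤i with i <? n
... | yes i<n = ⊥-elim (<⇒≱ i<n n≤i)
... | no _    = refl

∈ᵇ-true⁻ : ∀ {n i} (S : Subset n) → i ∈ᵇ S ≡ true → Σ (i < n) λ i<n → fromℕ< i<n ∈ S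
∈ᵇ-true⁻ {n} {i} S e with i <? n
... | yes i<n = i<n , lookup⇒[]= (fromℕ< i<n) S e

∈ᵇ-true : ∀ {n i} (S : Subset n) (i<n : i < n) → fromℕ< i<n ∈ S → i ∈ᵇ S ≡ true
∈ᵇ-true S i<n i∈S = trans (∈ᵇ-inside S i<n) ([]=⇒lookup i∈S)

count-∈ᵇ≤ : ∀ {A : Set} {n k} (side : A → Subset n) xs →
            (∀ x → length (filter (λ R → x ∈? side R) xs) ≤ k) → ∀ i → count (λ R → i ∈ᵇ side R) xs ≤ k
count-∈ᵇ≤ {n = n} {k} side xs uses≤ i = bound (i <? n)
  where
  bound : Dec (i < n) → count (λ R → i ∈ᵇ side R) xs ≤ k
  bound (yes i<n) = subst (_≤ k) (trans (length-filter-∈? side (fromℕ< i<n) xs)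
                                        (count-ext xs (λ R → sym (∈ᵇ-inside (side R) i<n))))
                          (uses≤ (fromℕ< i<n))
  bound (no i≮n)  = subst (_≤ k) (sym (count-none xs (λ R → ∈ᵇ-outside (side R) (≮⇒≥ i≮n)))) z≤n

module _ {r c : ℕ} (Y : Diagram r c) where

  at-true⁻ : ∀ {i j} → at Y i j ≡ true → Σ (i < r) λ i<r → Σ (j < c) λ j<c → Y (fromℕ< i<r) (fromℕ< j<c) ≡ true
  at-true⁻ {i} {j} e with i <? r | j <? c
  ... | yes i<r | yes j<c = i<r , j<c , e

  at-true : ∀ {i j} (i<r : i < r) (j<c : j < c) → Y (fromℕ< i<r) (fromℕ< j<c) ≡ true → at Y i j ≡ true
  at-true {i} {j} i<r j<c e with i <? r | j <? c
  ... | yes _ | yes _ = e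
  ... | no i≮r | _    = ⊥-elim (i≮r i<r)
  ... | yes _ | no j≮c = ⊥-elim (j≮c j<c)

  at-toℕ : ∀ i j → at Y (toℕ i) (toℕ j) ≡ Y i j
  at-toℕ i j with toℕ i <? r | toℕ j <? c
  ... | yes i<r | yes j<c = cong₂ Y (fromℕ<-toℕ i i<r) (fromℕ<-toℕ j j<c)
  ... | no i≮r  | _       = ⊥-elim (i≮r (toℕ<n i))
  ... | yes _   | no j≮c  = ⊥-elim (j≮c (toℕ<n j))

  at-outside : ∀ {i j} → r ≤ i ⊎ c ≤ j → at Y i j ≡ false
  at-outside {i} {j} outside with at Y i j in e
  ... | false = refl
  ... | true with at-true⁻ e | outside
  ...   | i<r , _ , _ | inj₁ r≤i = ⊥-elim (<⇒≱ i<r r≤i)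
  ...   | _ , j<c , _ | inj₂ c≤j = ⊥-elim (<⇒≱ j<c c≤j)

-- Cell t of a row of length L lying above a row of length L′ is a step.
isCorner : ℕ → ℕ → ℕ → Bool
isCorner L L′ t = (t <ᵇ L) ∧ not (t <ᵇ L′) ∧ not (suc t <ᵇ L)

countBelow-isCorner : ∀ c L L′ → L ≤ c → countBelow c (isCorner L L′) ≡ indicator (L′ <ᵇ L)
countBelow-isCorner c zero    L′ _   = countBelow-none c (λ _ _ → refl)
countBelow-isCorner c (suc L) L′ L<c = trans (sumBelow-single c L _ L<c elsewhere) (cong indicator last)
  where
  elsewhere : ∀ t → t ≢ L → indicator (isCorner (suc L) L′ t) ≡ 0
  elsewhere t t≢L with isCorner (suc L) L′ t in e
  ... | false = refl
  ... | true  = ⊥-elim (t≢L (≤-antisym (s≤s⁻¹ (<ᵇ-true⁻ (∧-true⁻ˡ e)))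
                                       (<ᵇ-false⁻ (not-true⁻ (∧-true⁻ʳ {not (t <ᵇ L′)} (∧-true⁻ʳ {t <ᵇ suc L} e))))))
  last : isCorner (suc L) L′ L ≡ (L′ <ᵇ suc L)
  last rewrite <ᵇ-true (n<1+n L) | <ᵇ-false (≤-refl {L}) | Bool.∧-identityʳ (not (L <ᵇ L′)) = not-<ᵇ L L′

module Young {r c : ℕ} (Y : Diagram r c) (young : IsYoung Y) where

  rowLength : ℕ → ℕ
  rowLength i = countBelow c (at Y i)

  colHeight : ℕ → ℕ
  colHeight j = countBelow r (λ i → at Y i j)

  at-rowLength : ∀ i j → at Y i j ≡ (j <ᵇ rowLength i)
  at-rowLength i = downClosed-initial c (at Y i) (proj₂ young i) (λ j c≤j → at-outside Y (inj₂ c≤j))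

  at-colHeight : ∀ i j → at Y i j ≡ (i <ᵇ colHeight j)
  at-colHeight i j =
    downClosed-initial r (λ i → at Y i j) (λ i → proj₁ young i j) (λ i r≤i → at-outside Y (inj₁ r≤i)) i

  <rowLength : ∀ {i j} → at Y i j ≡ true → j < rowLength i
  <rowLength {i} {j} e = <ᵇ-true⁻ (trans (sym (at-rowLength i j)) e)

  <rowLength⁻ : ∀ {i j} → j < rowLength i → at Y i j ≡ true
  <rowLength⁻ {i} {j} j<len = trans (at-rowLength i j) (<ᵇ-true j<len)

  <colHeight : ∀ {i j} → at Y i j ≡ true → i < colHeight j
  <colHeight {i} {j} e = <ᵇ-true⁻ (trans (sym (at-colHeight i j)) e)

  <colHeight⁻ : ∀ {i j} → i < colHeight j → at Y i j ≡ true
  <colHeight⁻ {i} {j} i<hgt = trans (at-colHeight i j) (<ᵇ-true i<hgt)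

  rowLength-antitone : ∀ {i i′} → i ≤ i′ → rowLength i′ ≤ rowLength i
  rowLength-antitone = antitone-step rowLength (λ i → sumBelow-mono c (λ j _ → indicator-mono (proj₁ young i j)))

  rowLength-outside : ∀ {i} → r ≤ i → rowLength i ≡ 0
  rowLength-outside r≤i = countBelow-none c (λ j _ → at-outside Y (inj₁ r≤i))

  isStepRow : ℕ → Bool
  isStepRow i = rowLength (suc i) <ᵇ rowLength i

  level : ℕ → ℕ
  level i = countBelow i isStepRow

  level-suc : ∀ i → level (suc i) ≡ level i + indicator (isStepRow i)
  level-suc i = sumBelow-suc i (indicator ∘ isStepRow)

  level-mono : ∀ {i i′} → i ≤ i′ → level i ≤ level i′
  level-mono = monotone-step level (λ i → subst (level i ≤_) (sym (level-suc i)) (m≤m+n (level i) _))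

  colLevel : ℕ → ℕ
  colLevel j = level (colHeight j)

  bottom-isStepRow : ∀ {j μ} → colHeight j ≡ suc μ → isStepRow μ ≡ true
  bottom-isStepRow {j} {μ} h≡ = <ᵇ-true (≤-<-trans shorter (<rowLength inside))
    where
    inside : at Y μ j ≡ true
    inside = <colHeight⁻ (≤-reflexive (sym h≡))
    shorter : rowLength (suc μ) ≤ j
    shorter = <ᵇ-false⁻ (begin
      j <ᵇ rowLength (suc μ)   ≡⟨ at-rowLength (suc μ) j ⟨
      at Y (suc μ) j           ≡⟨ at-colHeight (suc μ) j ⟩
      suc μ <ᵇ colHeight j     ≡⟨ <ᵇ-false (≤-reflexive h≡) ⟩
      false                    ∎)
      where open ≡-Reasoning

  at⇒level< : ∀ {i j} → at Y i j ≡ true → level i < colLevel j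
  at⇒level< {i} {j} e = below-bottom (colHeight j) refl (<colHeight e)
    where
    below-bottom : ∀ h → colHeight j ≡ h → i < h → level i < colLevel j
    below-bottom (suc μ) h≡ i<h rewrite h≡ | level-suc μ | bottom-isStepRow h≡ =
      ≤-<-trans (level-mono (s≤s⁻¹ i<h)) (m<m+n (level μ) z<s)

  level<⇒at : ∀ {i j} → level i < colLevel j → at Y i j ≡ true
  level<⇒at {i} {j} lt with i <? colHeight j
  ... | yes i<h = <colHeight⁻ i<h
  ... | no i≮h  = ⊥-elim (<⇒≱ lt (level-mono (≮⇒≥ i≮h)))

  steps≡level : steps Y ≡ level r
  steps≡level = sum-allFin r _ (indicator ∘ isStepRow) row
    where
    row : ∀ s → sum (map (λ t → if isStep Y s t then 1 else 0) (allFin c)) ≡ indicator (isStepRow (toℕ s))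
    row s = begin
      sum (map (λ t → if isStep Y s t then 1 else 0) (allFin c))
        ≡⟨ sum-allFin c _ (indicator ∘ isCorner (rowLength i) (rowLength (suc i))) cell ⟩
      countBelow c (isCorner (rowLength i) (rowLength (suc i)))
        ≡⟨ countBelow-isCorner c (rowLength i) _ (countBelow≤ c (at Y i)) ⟩
      indicator (isStepRow i) ∎
      where
      open ≡-Reasoning
      i = toℕ s
      cell : ∀ t → (if isStep Y s t then 1 else 0) ≡
                   indicator (isCorner (rowLength i) (rowLength (suc i)) (toℕ t))
      cell t rewrite if-indicator (isStep Y s t) | sym (at-toℕ Y s t)
                   | at-rowLength i (toℕ t) | at-rowLength (suc i) (toℕ t) | at-rowLength i (suc (toℕ t)) = refl

module Necessity {r c k} (Y : Diagram r c) (young : IsYoung Y) (Cs : List (Rect r c)) (cover : Covers Y Cs)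
                 (rowUse≤ : ∀ i → rowUse i Cs ≤ k) (colUse≤ : ∀ j → colUse j Cs ≤ k) where
  open Young Y young

  -- Point q stands for row q and, if q = p + 1, also for the column of the last cell of row p.
  stepPoint : ℕ → Bool
  stepPoint zero    = true
  stepPoint (suc i) = isStepRow i

  rowsAt : Rect r c → ℕ → Bool
  rowsAt R p = p ∈ᵇ proj₁ R

  colsAt : Rect r c → ℕ → Bool
  colsAt R zero    = false
  colsAt R (suc p) = (rowLength p ∸ 1) ∈ᵇ proj₂ R

  open StaircaseBound rowsAt colsAt Cs (suc r)

  rowLength-positive : ∀ {j} → isStepRow j ≡ true → 0 < rowLength j
  rowLength-positive step = ≤-<-trans z≤n (<ᵇ-true⁻ step)

  lastCell<rowLength : ∀ {i j} → isStepRow j ≡ true → i ≤ j → rowLength j ∸ 1 < rowLength i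
  lastCell<rowLength step i≤j = <-≤-trans (∸1< (rowLength-positive step)) (rowLength-antitone i≤j)

  inRect : ∀ {R i j} → RectIn Y R → i ∈ᵇ proj₁ R ≡ true → j ∈ᵇ proj₂ R ≡ true → at Y i j ≡ true
  inRect {R} inY i∈ j∈ with ∈ᵇ-true⁻ (proj₁ R) i∈ | ∈ᵇ-true⁻ (proj₂ R) j∈
  ... | i<r , i∈S | j<c , j∈T = at-true Y i<r j<c (inY _ _ i∈S j∈T)

  staircase : Staircase stepPoint
  staircase = record { bounded = bounded ; separated = All.map separated (proj₁ cover) ; covered = covered }
    where
    bounded : ∀ p → stepPoint p ≡ true → p < suc r
    bounded zero    _    = z<s
    bounded (suc i) step =
      s<s (≰⇒> (λ r≤i → n≮0 (subst (rowLength (suc i) <_) (rowLength-outside r≤i) (<ᵇ-true⁻ step))))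
    separated : ∀ {R} → RectIn Y R → SeparatedOn stepPoint R
    separated {R} inY {i} {suc j} _ step ri cj with i <? suc j
    ... | yes i<1+j = i<1+j
    ... | no i≮1+j  = ⊥-elim (<⇒≱ (<ᵇ-true⁻ step) (≤-trans lenj≤leni (rowLength-antitone (≮⇒≥ i≮1+j))))
      where
      lenj≤leni : rowLength j ≤ rowLength i
      lenj≤leni = ∸1<⇒≤ (rowLength-positive step) (<rowLength (inRect {R} inY ri cj))
    covered : ∀ {i j} → stepPoint i ≡ true → stepPoint j ≡ true → i < j →
              Any (λ R → rowsAt R i ≡ true × colsAt R j ≡ true) Cs
    covered {i} {suc j} _ step i<1+j with at-true⁻ Y (<rowLength⁻ (lastCell<rowLength step (s≤s⁻¹ i<1+j)))
    ... | i<r , j<c , inY =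
      Any.map (λ (i∈ , j∈) → ∈ᵇ-true _ i<r i∈ , ∈ᵇ-true _ j<c j∈) (proj₂ cover _ _ inY)

  rowDegree≤k : RowDegree≤ stepPoint k
  rowDegree≤k i _ = ≤-trans (count-mono Cs (λ R → ∧-true⁻ˡ)) (count-∈ᵇ≤ proj₁ Cs rowUse≤ i)

  colDegree≤k : ColDegree≤ stepPoint k
  colDegree≤k zero    _ = subst (_≤ k) (sym (count-none Cs (λ _ → refl))) z≤n
  colDegree≤k (suc j) _ = ≤-trans (count-mono Cs (λ R → ∧-true⁻ˡ)) (count-∈ᵇ≤ proj₂ Cs colUse≤ (rowLength j ∸ 1))

  fewSteps : steps Y < (2 * k) C k
  fewSteps rewrite steps≡level | twice k = size≤binomial k k staircase rowDegree≤k colDegree≤k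

module Sufficiency {r c : ℕ} (Y : Diagram r c) (young : IsYoung Y) where
  open Young Y young

  pullback : Rectangleℕ → Rect r c
  pullback (I , J) = Vec.tabulate (λ i → I (level (toℕ i))) , Vec.tabulate (λ j → J (colLevel (toℕ j)))

  pullback-inside : ∀ x → RowsBeforeCols x → RectIn Y (pullback x)
  pullback-inside (I , J) sep i j i∈ j∈ = trans (sym (at-toℕ Y i j))
    (level<⇒at (sep (∈-tabulate⁻ (λ i → I (level (toℕ i))) i i∈) (∈-tabulate⁻ (λ j → J (colLevel (toℕ j))) j j∈)))

  use-pullback : ∀ {n} (side : Rect r c → Subset n) (sideℕ : Rectangleℕ → ℕ → Bool) (h : Fin n → ℕ) →
                 (∀ x y → lookup (side (pullback x)) y ≡ sideℕ x (h y)) →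
                 ∀ y L → length (filter (λ R → y ∈? side R) (map pullback L)) ≡ occurrences (h y) (map sideℕ L)
  use-pullback side sideℕ h side≡ y L = begin
    length (filter (λ R → y ∈? side R) (map pullback L))   ≡⟨ length-filter-∈? side y (map pullback L) ⟩
    count (λ R → lookup (side R) y) (map pullback L)        ≡⟨ count-map _ pullback L ⟩
    count (λ x → lookup (side (pullback x)) y) L            ≡⟨ count-ext L (λ x → side≡ x y) ⟩
    count (λ x → sideℕ x (h y)) L                           ≡⟨ count-map _ sideℕ L ⟨
    occurrences (h y) (map sideℕ L)                          ∎
    where open ≡-Reasoning

  coverOfFewSteps : ∀ {k} → steps Y < (2 * k) C k →
    Σ (List (Rect r c)) (λ Cs → Covers Y Cs × (∀ i → rowUse i Cs ≤ k) × (∀ j → colUse j Cs ≤ k))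
  coverOfFewSteps {k} few
    with staircaseCover k k (suc (level r)) (subst₂ (λ s n → suc s ≤ n C k) steps≡level (twice k) few)
  ... | L , cover = map pullback L , (inside , coversY) , rowUse≤ , colUse≤
    where
    open StaircaseCover cover
    inside : All (RectIn Y) (map pullback L)
    inside = All.map⁺ (All.map (pullback-inside _) separated)
    coversY : ∀ i j → Y i j ≡ true → Any (λ R → i ∈ proj₁ R × j ∈ proj₂ R) (map pullback L)
    coversY i j inY = Any.map⁺ (Any.map (λ {x} (Ii , Jj) → ∈-tabulate _ i Ii , ∈-tabulate _ j Jj)
      (covers (at⇒level< (trans (at-toℕ Y i j) inY)) (s≤s (level-mono (countBelow≤ r _)))))
    rowUse≤ : ∀ i → rowUse i (map pullback L) ≤ k
    rowUse≤ i = subst (_≤ k) (sym (use-pullback proj₁ proj₁ (level ∘ toℕ) (λ x → lookup∘tabulate _) i L))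
                      (rowDegree≤ (level (toℕ i)))
    colUse≤ : ∀ j → colUse j (map pullback L) ≤ k
    colUse≤ j = subst (_≤ k) (sym (use-pullback proj₂ proj₂ (colLevel ∘ toℕ) (λ x → lookup∘tabulate _) j L))
                      (colDegree≤ (colLevel (toℕ j)))

theorem1 : (k : ℕ) → 1 ≤ k → (r c : ℕ) → (Y : Diagram r c) → IsYoung Y →
    (Σ (List (Rect r c)) (λ C → Covers Y C × (∀ (i : Fin r) → rowUse i C ≤ k) × (∀ (j : Fin c) → colUse j C ≤ k)))
      ⇔ (steps Y < (2 * k) C k)
theorem1 k _ r c Y young = mk⇔
  (λ (Cs , cover , rowUse≤ , colUse≤) → Necessity.fewSteps Y young Cs cover rowUse≤ colUse≤)
  (Sufficiency.coverOfFewSteps Y young)
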